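{- Let $X$ be a word set and $a\in\mathcal{L}_1(X)$. Then (1) the graph $G_X(a,1)$ is connected; (2) for every positive integer $N$ such that all words of $X$ have length at least $N$, if $G_X(a,N)$ is connected then $G_X(a,M)$ is connected for every positive integer $M\le N$.
   Context: Words over a finite alphabet may be finite (indexed from $0$), infinite or bi-infinite; a word set is any set of such words. For a word $w$, $w_{[i,j]}=w_i\dots w_j$. $\mathcal{L}_n(X)$ is the set of subwords (factors) of length $n$ of words of $X$. For a letter $a$ and $N\ge1$, $G_X(a,N)$ is the undirected graph whose vertices are the pairs $(i,u)$ with $0\le i<N$, $u\in\mathcal{L}_N(X)$, $u_i=a$, and whose edges are the pairs $\{(i,w_{[0,N-1]}),(i-1,w_{[1,N]})\}$ with $0<i<N$, $w\in\mathcal{L}_{N+1}(X)$, $w_i=a$. -}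

module Defs where

open import Data.Nat using (ℕ; zero; suc; _+_; _≤_)
open import Data.Integer using (ℤ; +_) renaming (_+_ to _+ℤ_)
open import Data.Fin using (Fin; toℕ; inject₁)
open import Data.Vec using (Vec; []; _∷_; lookup; tail; toList)
open import Data.List using (List; length; _++_)
open import Data.Product using (Σ; ∃; _×_; _,_)
open import Data.Unit using (⊤)
open import Relation.Binary.PropositionalEquality using (_≡_)
open import Relation.Binary.Construct.Closure.Symmetric using (SymClosure)
open import Relation.Binary.Construct.Closure.ReflexiveTransitive using (Star)

data Word (A : Set) : Set where
  finite   : List A → Word A
  infinite : (ℕ → A) → Word A
  biinf    : (ℤ → A) → Word A

LengthAtLeast : {A : Set} → ℕ → Word A → Set
LengthAtLeast N (finite l)   = N ≤ length l
LengthAtLeast N (infinite _) = ⊤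
LengthAtLeast N (biinf _)    = ⊤

OccursIn : {A : Set} {n : ℕ} → Vec A n → Word A → Set
OccursIn {A} u (finite l)   = Σ (List A) λ xs → Σ (List A) λ ys → l ≡ xs ++ toList u ++ ys
OccursIn {n = n} u (infinite f) = Σ ℕ λ k → (i : Fin n) → lookup u i ≡ f (k + toℕ i)
OccursIn {n = n} u (biinf f)    = Σ ℤ λ k → (i : Fin n) → lookup u i ≡ f (k +ℤ (+ toℕ i))

WordSet : Set → Set₁
WordSet A = Word A → Set

InLang : {A : Set} → WordSet A → (n : ℕ) → Vec A n → Set
InLang X n u = Σ (Word _) λ w → X w × OccursIn u w

dropLast : {A : Set} {n : ℕ} → Vec A (suc n) → Vec A n
dropLast {n = zero}  (x ∷ [])     = []
dropLast {n = suc n} (x ∷ y ∷ xs) = x ∷ dropLast (y ∷ xs)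

module _ {A : Set} (X : WordSet A) (a : A) (N : ℕ) where

  RawVertex : Set
  RawVertex = Fin N × Vec A N

  IsVertex : RawVertex → Set
  IsVertex (i , u) = InLang X N u × lookup u i ≡ a

  -- Edge {(i, w_[0,N-1]), (i-1, w_[1,N])} with 0 < i < N, w ∈ L_{N+1}(X), w_i = a.
  -- Here j plays the role of i-1.
  Edge : RawVertex → RawVertex → Set
  Edge (i , u) (j , v) = Σ (Vec A (suc N)) λ w →
    InLang X (suc N) w × toℕ i ≡ suc (toℕ j) × lookup w (inject₁ i) ≡ a
    × u ≡ dropLast w × v ≡ tail w

  Joined : RawVertex → RawVertex → Set
  Joined = Star (SymClosure Edge)

  Connected : Set
  Connected = (Σ RawVertex IsVertex)
    × ((x y : RawVertex) → IsVertex x → IsVertex y → Joined x y)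

-- A vertex (j , v) of G_X(a,M) is a length-M window of some factor u of X with the marked
-- letter a at position j. Among the windows of a fixed factor u around a fixed occurrence of
-- a, consecutive offsets r and r+1 are joined by an edge witnessed by the window of length
-- M+1 at offset r, so all such windows lie in one component. An edge of G_X(a,N) comes from
-- a factor of length N+1 whose two length-N windows keep the same occurrence of a, so every
-- path of G_X(a,N) projects to a path of G_X(a,M). Finally, since every word of X has length
-- at least N, every factor of length M lies in a factor of length N, so every vertex of
-- G_X(a,M) is a window of a vertex of G_X(a,N).
module Submission where

open import Defs
open import Data.Nat using (ℕ; zero; suc; _+_; _∸_; _≤_; _<_; s≤s; _≤?_; _<?_)
open import Data.Nat.Properties
open import Data.Integer using (ℤ) renaming (+_ to pos; _+_ to _+ℤ_)
import Data.Integer.Properties as ℤ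
open import Data.Fin using (Fin; toℕ; fromℕ; fromℕ<; inject₁) renaming (zero to fzero; suc to fsuc)
open import Data.Fin.Properties using (toℕ-fromℕ; toℕ-fromℕ<; toℕ-injective; toℕ<n; toℕ-inject₁)
open import Data.Vec using (Vec; []; _∷_; lookup; tail; toList; tabulate)
open import Data.Vec.Properties using (length-toList; lookup∘tabulate; tabulate∘lookup; tabulate-cong)
open import Data.List using (List; []; _∷_; length; _++_; take; drop)
open import Data.List.Properties using (length-++; length-drop; take++drop≡id; drop-drop)
open import Data.Product using (Σ; _×_; _,_; proj₁)
open import Data.Sum using (inj₁; inj₂)
open import Data.Unit using (⊤; tt)
open import Function using (_∘_)
open import Relation.Nullary using (yes; no)
open import Relation.Binary.PropositionalEquality
open import Relation.Binary.Construct.Closure.Symmetric using (SymClosure; fwd; bwd; symmetric)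
open import Relation.Binary.Construct.Closure.ReflexiveTransitive using (ε; _◅_; _◅◅_; reverse)

enclosing-interval : ∀ {k M N L} → k + M ≤ L → N ≤ L → M ≤ N →
  Σ ℕ λ s → Σ ℕ λ t → s + N ≤ L × t + M ≤ N × s + t ≡ k
enclosing-interval {k} {M} {N} {L} k+M≤L N≤L M≤N with k + N ≤? L
... | yes k+N≤L = k , 0 , k+N≤L , M≤N , +-identityʳ k
... | no k+N≰L = s , k ∸ s , ≤-reflexive s+N≡L , t+M≤N , s+t≡k
  where
  s : ℕ
  s = L ∸ N
  s≤k : s ≤ k
  s≤k = m≤n+o⇒m∸n≤o L N (subst (L ≤_) (+-comm k N) (<⇒≤ (≰⇒> k+N≰L)))
  s+N≡L : s + N ≡ L
  s+N≡L = m∸n+n≡m N≤L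
  s+t≡k : s + (k ∸ s) ≡ k
  s+t≡k = m+[n∸m]≡n s≤k
  t+M≤N : (k ∸ s) + M ≤ N
  t+M≤N = +-cancelˡ-≤ s _ _ (begin
    s + ((k ∸ s) + M) ≡⟨ sym (+-assoc s (k ∸ s) M) ⟩
    (s + (k ∸ s)) + M ≡⟨ cong (_+ M) s+t≡k ⟩
    k + M             ≤⟨ k+M≤L ⟩
    L                 ≡⟨ sym s+N≡L ⟩
    s + N             ∎)
    where open ≤-Reasoning

offset-in-range : ∀ {r n L} → r + n ≤ L → (i : Fin n) → r + toℕ i < L
offset-in-range {r} r+n≤L i = <-≤-trans (+-monoʳ-< r (toℕ<n i)) r+n≤L

≡tabulate : ∀ {A : Set} {n} {u : Vec A n} {f : Fin n → A} → (∀ i → lookup u i ≡ f i) → u ≡ tabulate f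
≡tabulate {u = u} u≗f = trans (sym (tabulate∘lookup u)) (tabulate-cong u≗f)

module Reading {A : Set} (d : A) where

  -- Out-of-range positions read the junk letter d; every read below is in range.
  infixl 9 _‼_
  _‼_ : List A → ℕ → A
  []       ‼ _     = d
  (x ∷ xs) ‼ zero  = x
  (x ∷ xs) ‼ suc i = xs ‼ i

  ‼-++ʳ : ∀ xs ys i → (xs ++ ys) ‼ (length xs + i) ≡ ys ‼ i
  ‼-++ʳ []       ys i = refl
  ‼-++ʳ (x ∷ xs) ys i = ‼-++ʳ xs ys i

  ‼-drop : ∀ k (l : List A) i → drop k l ‼ i ≡ l ‼ (k + i)
  ‼-drop zero    l       i = refl
  ‼-drop (suc k) []      i = refl
  ‼-drop (suc k) (x ∷ l) i = ‼-drop k l i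

  lookup≡toList‼ : ∀ {n} (u : Vec A n) i → lookup u i ≡ toList u ‼ toℕ i
  lookup≡toList‼ (x ∷ u) fzero    = refl
  lookup≡toList‼ (x ∷ u) (fsuc i) = lookup≡toList‼ u i

  lookup≡toList++‼ : ∀ {n} (u : Vec A n) ys i → lookup u i ≡ (toList u ++ ys) ‼ toℕ i
  lookup≡toList++‼ (x ∷ u) ys fzero    = refl
  lookup≡toList++‼ (x ∷ u) ys (fsuc i) = lookup≡toList++‼ u ys i

  ‼-toList-tabulate : ∀ {n} (g : ℕ → A) {i} → i < n → toList (tabulate {n = n} (g ∘ toℕ)) ‼ i ≡ g i
  ‼-toList-tabulate {suc n} g {zero}  _         = refl
  ‼-toList-tabulate {suc n} g {suc i} (s≤s i<n) = ‼-toList-tabulate (g ∘ suc) i<n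

  toList-tabulate-‼ : ∀ {n} (l : List A) → n ≤ length l →
    toList (tabulate {n = n} (λ i → l ‼ toℕ i)) ≡ take n l
  toList-tabulate-‼ {zero}  l       _         = refl
  toList-tabulate-‼ {suc n} (x ∷ l) (s≤s n≤l) = cong (x ∷_) (toList-tabulate-‼ l n≤l)

  ‼-dropLast : ∀ {n} (w : Vec A (suc n)) {i} → i < n → toList (dropLast w) ‼ i ≡ toList w ‼ i
  ‼-dropLast {suc n} (x ∷ y ∷ w) {zero}  _         = refl
  ‼-dropLast {suc n} (x ∷ y ∷ w) {suc i} (s≤s i<n) = ‼-dropLast (y ∷ w) i<n

  dropLast-tabulate : ∀ {n} (f : Fin (suc n) → A) → dropLast (tabulate f) ≡ tabulate (f ∘ inject₁)
  dropLast-tabulate {zero}  f = refl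
  dropLast-tabulate {suc n} f = cong (f fzero ∷_) (dropLast-tabulate (f ∘ fsuc))

  window : ∀ {L} → Vec A L → ℕ → (n : ℕ) → Vec A n
  window u r n = tabulate (λ i → toList u ‼ (r + toℕ i))

  lookup-window : ∀ {L} (u : Vec A L) r {n} (j : Fin n) → lookup (window u r n) j ≡ toList u ‼ (r + toℕ j)
  lookup-window u r j = lookup∘tabulate (λ i → toList u ‼ (r + toℕ i)) j

  dropLast-window : ∀ {L} (u : Vec A L) r n → dropLast (window u r (suc n)) ≡ window u r n
  dropLast-window u r n = trans (dropLast-tabulate (λ i → toList u ‼ (r + toℕ i)))
    (tabulate-cong λ i → cong (λ j → toList u ‼ (r + j)) (toℕ-inject₁ i))

  tail-window : ∀ {L} (u : Vec A L) r n → tail (window u r (suc n)) ≡ window u (suc r) n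
  tail-window u r n = tabulate-cong λ i → cong (toList u ‼_) (+-suc r (toℕ i))

  window-dropLast : ∀ {N} (w : Vec A (suc N)) {r n} → r + n ≤ N → window (dropLast w) r n ≡ window w r n
  window-dropLast w r+n≤N = tabulate-cong λ i → ‼-dropLast w (offset-in-range r+n≤N i)

  Pos : Word A → Set
  Pos (finite _)   = ℕ
  Pos (infinite _) = ℕ
  Pos (biinf _)    = ℤ

  shift : (w : Word A) → Pos w → ℕ → Pos w
  shift (finite _)   k r = k + r
  shift (infinite _) k r = k + r
  shift (biinf _)    k r = k +ℤ pos r

  letterAt : (w : Word A) → Pos w → A
  letterAt (finite l)   k = l ‼ k
  letterAt (infinite f) k = f k
  letterAt (biinf f)    k = f k

  Fits : (w : Word A) → Pos w → ℕ → Set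
  Fits (finite l)   k n = k + n ≤ length l
  Fits (infinite _) _ _ = ⊤
  Fits (biinf _)    _ _ = ⊤

  factorAt : (w : Word A) → Pos w → (n : ℕ) → Vec A n
  factorAt w k n = tabulate (λ i → letterAt w (shift w k (toℕ i)))

  OccursAt : ∀ {n} → Vec A n → Word A → Set
  OccursAt {n} u w = Σ (Pos w) λ k → Fits w k n × u ≡ factorAt w k n

  shift-+ : ∀ w (k : Pos w) r i → shift w (shift w k r) i ≡ shift w k (r + i)
  shift-+ (finite _)   k r i = +-assoc k r i
  shift-+ (infinite _) k r i = +-assoc k r i
  shift-+ (biinf _)    k r i = trans (ℤ.+-assoc k (pos r) (pos i)) (cong (k +ℤ_) (sym (ℤ.pos-+ r i)))

  Fits-shift : ∀ w {k L r n} → Fits w k L → r + n ≤ L → Fits w (shift w k r) n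
  Fits-shift (finite l)   {k} {r = r} {n} k+L≤l r+n≤L =
    subst (_≤ length l) (sym (+-assoc k r n)) (≤-trans (+-monoʳ-≤ k r+n≤L) k+L≤l)
  Fits-shift (infinite _) _ _ = tt
  Fits-shift (biinf _)    _ _ = tt

  window-factorAt : ∀ w k {L r n} → r + n ≤ L → window (factorAt w k L) r n ≡ factorAt w (shift w k r) n
  window-factorAt w k {r = r} r+n≤L = tabulate-cong λ i →
    trans (‼-toList-tabulate (λ j → letterAt w (shift w k j)) (offset-in-range r+n≤L i))
          (cong (letterAt w) (sym (shift-+ w k r (toℕ i))))

  widen : ∀ w {M N} (k : Pos w) → Fits w k M → LengthAtLeast N w → M ≤ N →
    Σ (Pos w) λ s → Σ ℕ λ t → Fits w s N × t + M ≤ N × shift w s t ≡ k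
  widen (finite l)   k k+M≤l N≤l M≤N = enclosing-interval k+M≤l N≤l M≤N
  widen (infinite _) k _ _ M≤N = k , 0 , tt , M≤N , +-identityʳ k
  widen (biinf _)    k _ _ M≤N = k , 0 , tt , M≤N , ℤ.+-identityʳ k

  occursIn⇒occursAt : ∀ {n} {u : Vec A n} w → OccursIn u w → OccursAt u w
  occursIn⇒occursAt {n} {u} (finite _) (xs , ys , refl) =
    length xs , fits , ≡tabulate λ i → trans (lookup≡toList++‼ u ys i) (sym (‼-++ʳ xs _ (toℕ i)))
    where
    fits : length xs + n ≤ length (xs ++ toList u ++ ys)
    fits = begin
      length xs + n                                ≤⟨ +-monoʳ-≤ (length xs) (m≤m+n n (length ys)) ⟩
      length xs + (n + length ys)                  ≡⟨ cong (λ j → length xs + (j + length ys))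
                                                              (sym (length-toList u)) ⟩
      length xs + (length (toList u) + length ys)  ≡⟨ cong (length xs +_) (sym (length-++ (toList u))) ⟩
      length xs + length (toList u ++ ys)          ≡⟨ sym (length-++ xs) ⟩
      length (xs ++ toList u ++ ys)                ∎
      where open ≤-Reasoning
  occursIn⇒occursAt (infinite _) (k , u≗) = k , tt , ≡tabulate u≗
  occursIn⇒occursAt (biinf _)    (k , u≗) = k , tt , ≡tabulate u≗

  occursAt⇒occursIn : ∀ {n} {u : Vec A n} w → OccursAt u w → OccursIn u w
  occursAt⇒occursIn {n} (finite l) (k , k+n≤l , refl) = take k l , drop (k + n) l , split
    where
    n≤rest : n ≤ length (drop k l)
    n≤rest = subst (n ≤_) (sym (length-drop k l))
      (subst (_≤ length l ∸ k) (m+n∸m≡n k n) (∸-monoˡ-≤ k k+n≤l))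
    factor≡ : toList (factorAt (finite l) k n) ≡ take n (drop k l)
    factor≡ = trans (cong toList (tabulate-cong λ i → sym (‼-drop k l (toℕ i))))
      (toList-tabulate-‼ (drop k l) n≤rest)
    split : l ≡ take k l ++ toList (factorAt (finite l) k n) ++ drop (k + n) l
    split = begin
      l                                                   ≡⟨ sym (take++drop≡id k l) ⟩
      take k l ++ drop k l                                ≡⟨ cong (take k l ++_) (sym (take++drop≡id n (drop k l))) ⟩
      take k l ++ take n (drop k l) ++ drop n (drop k l)  ≡⟨ cong₂ (λ xs ys → take k l ++ xs ++ ys)
                                                                  (sym factor≡) (drop-drop k n l) ⟩
      take k l ++ toList (factorAt (finite l) k n) ++ drop (k + n) l ∎
      where open ≡-Reasoning
  occursAt⇒occursIn (infinite _) (k , _ , refl) = k , lookup∘tabulate _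
  occursAt⇒occursIn (biinf _)    (k , _ , refl) = k , lookup∘tabulate _

  InLang-window : ∀ (X : WordSet A) {L} {u : Vec A L} {r n} → InLang X L u → r + n ≤ L →
    InLang X n (window u r n)
  InLang-window X {r = r} (w , Xw , u∈w) r+n≤L with occursIn⇒occursAt w u∈w
  ... | k , fits , refl = w , Xw ,
    occursAt⇒occursIn w (shift w k r , Fits-shift w fits r+n≤L , window-factorAt w k r+n≤L)

  InLang-extend : ∀ (X : WordSet A) {M N} {v : Vec A M} →
    ((w : Word A) → X w → LengthAtLeast N w) → M ≤ N → InLang X M v →
    Σ (Vec A N) λ u → InLang X N u × Σ ℕ λ t → t + M ≤ N × v ≡ window u t M
  InLang-extend X {N = N} long M≤N (w , Xw , v∈w) with occursIn⇒occursAt w v∈w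
  ... | k , fits , refl with widen w k fits (long w Xw) M≤N
  ... | s , t , fitsN , t+M≤N , refl =
    factorAt w s N , (w , Xw , occursAt⇒occursIn w (s , fitsN , refl)) , t , t+M≤N ,
    sym (window-factorAt w s t+M≤N)

connected-length-one : ∀ {k} (X : WordSet (Fin k)) (a : Fin k) → InLang X 1 (a ∷ []) → Connected X a 1
connected-length-one X a a∈X = ((fzero , a ∷ []) , a∈X , refl) , joined
  where
  joined : (x y : RawVertex X a 1) → IsVertex X a 1 x → IsVertex X a 1 y → Joined X a 1 x y
  joined (fzero , b ∷ []) (fzero , c ∷ []) (_ , refl) (_ , refl) = ε

module Windows {A : Set} (X : WordSet A) (a : A) (m : ℕ) where
  open Reading a

  M : ℕ
  M = suc m

  WindowAround : ∀ {L} → Vec A L → ℕ → RawVertex X a M → Set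
  WindowAround {L} u p (j , v) = Σ ℕ λ r → r + M ≤ L × r + toℕ j ≡ p × v ≡ window u r M

  WindowOf : ∀ {N} → RawVertex X a N → RawVertex X a M → Set
  WindowOf (i , u) = WindowAround u (toℕ i)

  window-exists : ∀ {L} (u : Vec A L) {p} → p < L → M ≤ L → Σ (RawVertex X a M) (WindowAround u p)
  window-exists {L} u {p} p<L M≤L with p <? M
  ... | yes p<M = (fromℕ< p<M , window u 0 M) , 0 , M≤L , toℕ-fromℕ< p<M , refl
  ... | no p≮M = (fromℕ m , window u (p ∸ m) M) , p ∸ m , bound , r+m≡p , refl
    where
    m≤p : m ≤ p
    m≤p = <⇒≤ (≮⇒≥ p≮M)
    r+m≡p : (p ∸ m) + toℕ (fromℕ m) ≡ p
    r+m≡p = trans (cong ((p ∸ m) +_) (toℕ-fromℕ m)) (m∸n+n≡m m≤p)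
    bound : (p ∸ m) + M ≤ L
    bound = subst (_≤ L) (sym (trans (+-suc (p ∸ m) m) (cong suc (m∸n+n≡m m≤p)))) p<L

  window-isVertex : ∀ {L} {u : Vec A L} {p y} → InLang X L u → toList u ‼ p ≡ a →
    WindowAround u p y → IsVertex X a M y
  window-isVertex {u = u} {y = j , _} u∈X up≡a (r , r+M≤L , r+j≡p , refl) =
    InLang-window X u∈X r+M≤L , trans (lookup-window u r j) (trans (cong (toList u ‼_) r+j≡p) up≡a)

  window-edge : ∀ {L} {u : Vec A L} {r} (k : Fin m) → InLang X L u → suc r + M ≤ L →
    toList u ‼ (r + suc (toℕ k)) ≡ a → Edge X a M (fsuc k , window u r M) (inject₁ k , window u (suc r) M)
  window-edge {L} {u} {r} k u∈X bound letter =
    window u r (suc M) , InLang-window X u∈X (subst (_≤ L) (sym (+-suc r M)) bound) ,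
    cong suc (sym (toℕ-inject₁ k)) ,
    trans (lookup-window u r (inject₁ (fsuc k)))
      (trans (cong (λ j → toList u ‼ (r + suc j)) (toℕ-inject₁ k)) letter) ,
    sym (dropLast-window u r M) , sym (tail-window u r M)

  slide : ∀ {L} {u : Vec A L} → InLang X L u → ∀ d {r r'} → r' ≡ d + r →
    (j j' : Fin M) → toℕ j ≡ d + toℕ j' → r' + M ≤ L → toList u ‼ (r + toℕ j) ≡ a →
    Joined X a M (j , window u r M) (j' , window u r' M)
  slide u∈X zero    refl j j' j≡j' _ _ rewrite toℕ-injective j≡j' = ε
  slide {u = u} u∈X (suc d) {r} r'≡ (fsuc k) j' k≡ r'+M≤L letter =
    fwd (window-edge k u∈X (≤-trans (+-monoˡ-≤ M suc-r≤r') r'+M≤L) letter) ◅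
    slide u∈X d (trans r'≡ (sym (+-suc d r))) (inject₁ k) j'
      (trans (toℕ-inject₁ k) (suc-injective k≡)) r'+M≤L letter′
    where
    letter′ : toList u ‼ (suc r + toℕ (inject₁ k)) ≡ a
    letter′ = trans (cong (λ j → toList u ‼ suc (r + j)) (toℕ-inject₁ k))
      (trans (cong (toList u ‼_) (sym (+-suc r (toℕ k)))) letter)
    suc-r≤r' : suc r ≤ _
    suc-r≤r' = subst (suc r ≤_) (sym r'≡) (s≤s (m≤n+m r d))

  windows-joined-≤ : ∀ {L} {u : Vec A L} {p y y'} → InLang X L u → toList u ‼ p ≡ a →
    (wy : WindowAround u p y) (wy' : WindowAround u p y') → proj₁ wy ≤ proj₁ wy' → Joined X a M y y'
  windows-joined-≤ {u = u} {y = j , _} {j' , _} u∈X up≡a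
                   (r , _ , r+j≡p , refl) (r' , r'+M≤L , r'+j'≡p , refl) r≤r' =
    slide u∈X (r' ∸ r) (sym (m∸n+n≡m r≤r')) j j' offsets r'+M≤L (trans (cong (toList u ‼_) r+j≡p) up≡a)
    where
    offsets : toℕ j ≡ (r' ∸ r) + toℕ j'
    offsets = +-cancelˡ-≡ r _ _ (begin
      r + toℕ j                ≡⟨ trans r+j≡p (sym r'+j'≡p) ⟩
      r' + toℕ j'              ≡⟨ cong (_+ toℕ j') (sym (m+[n∸m]≡n r≤r')) ⟩
      r + (r' ∸ r) + toℕ j'    ≡⟨ +-assoc r (r' ∸ r) (toℕ j') ⟩
      r + ((r' ∸ r) + toℕ j')  ∎)
      where open ≡-Reasoning

  windows-joined : ∀ {L} {u : Vec A L} {p y y'} → InLang X L u → toList u ‼ p ≡ a →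
    WindowAround u p y → WindowAround u p y' → Joined X a M y y'
  windows-joined u∈X up≡a wy wy' with ≤-total (proj₁ wy) (proj₁ wy')
  ... | inj₁ r≤r' = windows-joined-≤ u∈X up≡a wy wy' r≤r'
  ... | inj₂ r'≤r = reverse (symmetric _) (windows-joined-≤ u∈X up≡a wy' wy r'≤r)

  WindowAround-dropLast : ∀ {N} {w : Vec A (suc N)} {p y} → WindowAround (dropLast w) p y → WindowAround w p y
  WindowAround-dropLast {w = w} {y = _ , _} (r , r+M≤N , r+j≡p , refl) =
    r , m≤n⇒m≤1+n r+M≤N , r+j≡p , window-dropLast w r+M≤N

  WindowAround-tail : ∀ {N} {w : Vec A (suc N)} {p y} → WindowAround (tail w) p y → WindowAround w (suc p) y
  WindowAround-tail {w = _ ∷ _} {y = _ , _} (r , r+M≤N , r+j≡p , refl) =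
    suc r , s≤s r+M≤N , cong suc r+j≡p , refl

  -- Both ends of an edge of G_X(a,N) are windows of one factor of length N+1 around one occurrence of a.
  edge-windows-joined : ∀ {N x z x' z'} → Edge X a N x z → WindowOf x x' → WindowOf z z' → Joined X a M x' z'
  edge-windows-joined {x = i , _} {j , _} (w , w∈X , i≡1+j , wi≡a , refl , refl) wx wz =
    windows-joined w∈X wi≡a′ (WindowAround-dropLast {w = w} wx)
      (subst (λ p → WindowAround w p _) (sym i≡1+j) (WindowAround-tail {w = w} wz))
    where
    wi≡a′ : toList w ‼ toℕ i ≡ a
    wi≡a′ = trans (cong (toList w ‼_) (sym (toℕ-inject₁ i)))
      (trans (sym (lookup≡toList‼ w (inject₁ i))) wi≡a)

  step-windows-joined : ∀ {N x z x' z'} → SymClosure (Edge X a N) x z →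
    WindowOf x x' → WindowOf z z' → Joined X a M x' z'
  step-windows-joined (fwd e) wx wz = edge-windows-joined e wx wz
  step-windows-joined (bwd e) wx wz = reverse (symmetric _) (edge-windows-joined e wz wx)

  windows-joined-along : ∀ {N x y x' y'} → M ≤ N → Joined X a N x y → IsVertex X a N y →
    WindowOf x x' → WindowOf y y' → Joined X a M x' y'
  windows-joined-along {y = j , v} _ ε (v∈X , vj≡a) wx wy =
    windows-joined v∈X (trans (sym (lookup≡toList‼ v j)) vj≡a) wx wy
  windows-joined-along M≤N (_◅_ {j = k , u} step path) vy wx wy =
    let z' , wz = window-exists u (toℕ<n k) M≤N
    in step-windows-joined step wx wz ◅◅ windows-joined-along M≤N path vy wz wy

  vertex-lift : ∀ {N y} → ((w : Word A) → X w → LengthAtLeast N w) → M ≤ N → IsVertex X a M y →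
    Σ (RawVertex X a N) λ x → IsVertex X a N x × WindowOf x y
  vertex-lift {N} {y = j , _} long M≤N (v∈X , vj≡a) with InLang-extend X long M≤N v∈X
  ... | u , u∈X , t , t+M≤N , refl =
    (fromℕ< p<N , u) , (u∈X , ui≡a) , t , t+M≤N , sym (toℕ-fromℕ< p<N) , refl
    where
    p<N : t + toℕ j < N
    p<N = offset-in-range t+M≤N j
    ui≡a : lookup u (fromℕ< p<N) ≡ a
    ui≡a = begin
      lookup u (fromℕ< p<N)        ≡⟨ lookup≡toList‼ u (fromℕ< p<N) ⟩
      toList u ‼ toℕ (fromℕ< p<N)  ≡⟨ cong (toList u ‼_) (toℕ-fromℕ< p<N) ⟩
      toList u ‼ (t + toℕ j)       ≡⟨ sym (lookup-window u t j) ⟩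
      lookup (window u t M) j      ≡⟨ vj≡a ⟩
      a                            ∎
      where open ≡-Reasoning

  connected-windows : ∀ {N} → M ≤ N → ((w : Word A) → X w → LengthAtLeast N w) →
    Connected X a N → Connected X a M
  connected-windows M≤N long (((i , u) , u∈X , ui≡a) , joined) with window-exists u (toℕ<n i) M≤N
  ... | y₀ , wy₀ =
    (y₀ , window-isVertex u∈X (trans (sym (lookup≡toList‼ u i)) ui≡a) wy₀) , λ y y' vy vy' →
      let x , vx , wx = vertex-lift long M≤N vy
          x' , vx' , wx' = vertex-lift long M≤N vy'
      in windows-joined-along M≤N (joined x x' vx vx') vx' wx wx'

lemma1 : {k : ℕ} (X : WordSet (Fin k)) (a : Fin k) → InLang X 1 (a ∷ [])
    → Connected X a 1
      × ((N : ℕ) → 1 ≤ N → ((w : Word (Fin k)) → X w → LengthAtLeast N w)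
          → Connected X a N → (M : ℕ) → 1 ≤ M → M ≤ N → Connected X a M)
lemma1 X a a∈X = connected-length-one X a a∈X , λ where
  N _ long connected (suc m) _ M≤N → Windows.connected-windows X a m M≤N long connected
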